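{- Let $1\leq k\leq n$ be integers. If $\mathbf{A}$ is an $n$-ladder and $\mathbf{B}$ is a $k$-ladder, then there is a Tukey morphism $\mathbf{A}\to\mathbf{B}$.
   Context: A binary relation is a triple $\mathbf{A}=(A_-,A_+,A)$ where $A_-,A_+$ are sets and $A\subseteq A_-\times A_+$. A (Tukey) morphism from $\mathbf{A}$ to $\mathbf{B}$ is a pair of functions $\phi_-\colon B_-\to A_-$, $\phi_+\colon A_+\to B_+$ such that for all $b\in B_-$ and $a\in A_+$, $\phi_-(b)\mathrel{A}a$ implies $b\mathrel{B}\phi_+(a)$. An $n$-ladder is a binary relation $\mathbf{A}$ with $|A_-|=|A_+|=n\geq1$ such that $A$ is the graph of a bijection from $A_-$ to $A_+$. -}

module Defs where

open import Level using (Level; suc; _⊔_)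
open import Data.Nat using (ℕ; _≥_)
open import Data.Fin using (Fin)
open import Data.Product using (Σ; _×_; _,_)
open import Function.Bundles using (_↔_; _⤖_; _⇔_; Bijection)
open import Relation.Binary.PropositionalEquality using (_≡_)

record BinRel (ℓ : Level) : Set (suc ℓ) where
  field
    Neg : Set ℓ
    Pos : Set ℓ
    Rel : Neg → Pos → Set ℓ
open BinRel public

record TukeyMorphism {ℓ : Level} (𝐀 𝐁 : BinRel ℓ) : Set ℓ where
  field
    φ₋ : Neg 𝐁 → Neg 𝐀
    φ₊ : Pos 𝐀 → Pos 𝐁
    preserves : ∀ (b : Neg 𝐁) (a : Pos 𝐀) → Rel 𝐀 (φ₋ b) a → Rel 𝐁 b (φ₊ a)

record IsLadder {ℓ : Level} (n : ℕ) (𝐀 : BinRel ℓ) : Set ℓ where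
  field
    n≥1     : n ≥ 1
    cardNeg : Neg 𝐀 ↔ Fin n
    cardPos : Pos 𝐀 ↔ Fin n
    f       : Neg 𝐀 ⤖ Pos 𝐀
    graph   : ∀ x y → Rel 𝐀 x y ⇔ (Bijection.to f x ≡ y)

-- A Tukey morphism between relations that are graphs of bijections only needs
-- a retraction of the negative sides: if s : B₋ → A₋ has a left inverse r, put
-- φ₋ = s and φ₊ = g ∘ r ∘ f⁻¹, where f and g are the bijections of 𝐀 and 𝐁.
-- Then s b 𝐀 a forces f⁻¹ a = s b, so φ₊ a = g b and b 𝐁 φ₊ a. For ladders the
-- negative sides are Fin n and Fin k, and k ≤ n with k ≥ 1 gives the retraction:
-- include Fin k into Fin n and clamp Fin n onto Fin k.
module Submission where

open import Defs
open import Level using (Level)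
open import Data.Nat using (ℕ; suc; _≤_; s≤s; z≤n)
open import Data.Fin using (Fin; zero; suc; inject≤)
open import Function.Bundles using (_↪_; mk↪; RightInverse; Inverse; Equivalence)
open import Function.Construct.Composition using (_↪-∘_)
open import Function.Construct.Symmetry using (↔-sym)
open import Function.Properties.Bijection using (⤖⇒↔)
open import Function.Properties.Inverse using (↔⇒↪)
open import Relation.Binary.PropositionalEquality using (_≡_; refl; sym; trans; cong; subst)

private
  variable
    ℓ : Level

clamp : ∀ {n k} → Fin n → Fin (suc k)
clamp {k = 0}     _       = zero
clamp {k = suc k} zero    = zero
clamp {k = suc k} (suc i) = suc (clamp i)

clamp-inject≤ : ∀ {k n} (i : Fin (suc k)) .(k<n : suc k ≤ n) → clamp (inject≤ i k<n) ≡ i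
clamp-inject≤ {0}             zero    _   = refl
clamp-inject≤ {suc k} {suc n} zero    _   = refl
clamp-inject≤ {suc k} {suc n} (suc i) k<n = cong suc (clamp-inject≤ i _)

Fin↪Fin : ∀ {k n} → 1 ≤ k → k ≤ n → Fin k ↪ Fin n
Fin↪Fin (s≤s z≤n) k≤n = mk↪ {to = λ i → inject≤ i k≤n} {from = clamp}
  λ { {i} refl → clamp-inject≤ i k≤n }

tukey-from-retraction : (𝐀 𝐁 : BinRel ℓ)
  (h : Pos 𝐀 → Neg 𝐀) → (∀ {x a} → Rel 𝐀 x a → x ≡ h a) →
  (g : Neg 𝐁 → Pos 𝐁) → (∀ b → Rel 𝐁 b (g b)) →
  Neg 𝐁 ↪ Neg 𝐀 → TukeyMorphism 𝐀 𝐁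
tukey-from-retraction 𝐀 𝐁 h rel⇒≡h g relates-g s = record
  { φ₋        = to
  ; φ₊        = λ a → g (from (h a))
  ; preserves = preserves
  }
  where
  open RightInverse s using (to; from; strictlyInverseʳ)

  preserves : ∀ b a → Rel 𝐀 (to b) a → Rel 𝐁 b (g (from (h a)))
  preserves b a rel = subst (λ b′ → Rel 𝐁 b (g b′)) from-h-a≡b (relates-g b)
    where
    from-h-a≡b : b ≡ from (h a)
    from-h-a≡b = trans (sym (strictlyInverseʳ b)) (cong from (rel⇒≡h rel))

module Ladder {n : ℕ} {𝐀 : BinRel ℓ} (L : IsLadder n 𝐀) where
  open IsLadder L using (f; graph)
  open Inverse (⤖⇒↔ f) using (to) renaming (from to f⁻¹) public
  open Inverse (⤖⇒↔ f) using (strictlyInverseʳ)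

  relates-f : ∀ x → Rel 𝐀 x (to x)
  relates-f x = Equivalence.from (graph x (to x)) refl

  rel⇒≡f⁻¹ : ∀ {x a} → Rel 𝐀 x a → x ≡ f⁻¹ a
  rel⇒≡f⁻¹ {x} rel = trans (sym (strictlyInverseʳ x)) (cong f⁻¹ (Equivalence.to (graph x _) rel))

corollary2p4 : {ℓ : Level} (k n : ℕ) → 1 ≤ k → k ≤ n →
    (𝐀 𝐁 : BinRel ℓ) → IsLadder n 𝐀 → IsLadder k 𝐁 → TukeyMorphism 𝐀 𝐁
corollary2p4 k n 1≤k k≤n 𝐀 𝐁 LA LB =
  tukey-from-retraction 𝐀 𝐁 (Ladder.f⁻¹ LA) (Ladder.rel⇒≡f⁻¹ LA)
                            (Ladder.to LB) (Ladder.relates-f LB) negB↪negA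
  where
  negB↪negA : Neg 𝐁 ↪ Neg 𝐀
  negB↪negA = ↔⇒↪ (↔-sym (IsLadder.cardNeg LA))
          ↪-∘ (Fin↪Fin 1≤k k≤n ↪-∘ ↔⇒↪ (IsLadder.cardNeg LB))
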